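{- For every category $\mathcal C$, $\mathcal R^U(\mathcal C)$ is the Rezk completion of $\mathcal R^{\mathrm{set}}(\mathcal C)$: $\mathcal R^U(\mathcal C)$ is a univalent category and there is a fully faithful and essentially surjective functor $\mathcal R^{\mathrm{set}}(\mathcal C)\to\mathcal R^U(\mathcal C)$.
   Context: We work in univalent foundations. A category has a type of objects, hom-sets, and associative unital composition; it is univalent if for all objects $a,b$ the canonical map $(a=b)\to(a\cong b)$ is an equivalence. A Rezk completion of a category $\mathcal A$ is a univalent category $\mathcal B$ with a fully faithful, essentially surjective functor $\mathcal A\to\mathcal B$. "Merely exists" means the propositional truncation of the corresponding $\Sigma$-type is inhabited. $P\mathcal C=[\mathcal C^{op},\mathbf{Set}]$, and $\mathbf y$ is the Yoneda embedding. For objects $X,Y$, $X\triangleleft Y$ is the type of pairs $r:Y\to X$, $s:X\to Y$ with $r\circ s=\mathrm{id}_X$. $\mathcal R^{\mathrm{set}}(\mathcal C)$ is the category whose objects are pairs $(X,f)$ with $f:X\to X$, $f\circ f=f$; morphisms $(X_1,f_1)\to(X_2,f_2)$ are $g:X_1\to X_2$ with $f_2\circ g\circ f_1=g$; identity on $(X,f)$ is $f$; composition from $\mathcal C$. $\mathcal R^U(\mathcal C)$ is the full subcategory of $P\mathcal C$ on presheaves $F$ for which there merely exist an object $X$ of $\mathcal C$ and $(r,s):F\triangleleft\mathbf y(X)$. -}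

{-# OPTIONS --without-K #-}
module Defs where

open import Level using (Level; _⊔_; suc; Setω)
open import Relation.Binary.PropositionalEquality
  using (_≡_; refl; sym; trans; cong; trans-symˡ)
open import Data.Product using (Σ; _,_; proj₁; proj₂; _×_)

isContr : ∀ {a} → Set a → Set a
isContr A = Σ A λ c → ∀ x → c ≡ x

isProp : ∀ {a} → Set a → Set a
isProp A = (x y : A) → x ≡ y

isSet : ∀ {a} → Set a → Set a
isSet A = (x y : A) → isProp (x ≡ y)

fiber : ∀ {a b} {A : Set a} {B : Set b} → (A → B) → B → Set (a ⊔ b)
fiber {A = A} f y = Σ A λ x → f x ≡ y

isEquiv : ∀ {a b} {A : Set a} {B : Set b} → (A → B) → Set (a ⊔ b)
isEquiv f = ∀ y → isContr (fiber f y)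

_≃_ : ∀ {a b} → Set a → Set b → Set (a ⊔ b)
A ≃ B = Σ (A → B) isEquiv

idIsEquiv : ∀ {a} {A : Set a} → isEquiv (λ (x : A) → x)
idIsEquiv y = (y , refl) , λ { (x , refl) → refl }

idtoeqv : ∀ {a} {A B : Set a} → A ≡ B → A ≃ B
idtoeqv refl = (λ x → x) , idIsEquiv

Univalence : Setω
Univalence = ∀ {ℓ} {A B : Set ℓ} → isEquiv (idtoeqv {A = A} {B = B})

FunExt : Setω
FunExt = ∀ {a b} {A : Set a} {B : A → Set b} {f g : (x : A) → B x}
       → (∀ x → f x ≡ g x) → f ≡ g

-- Propositional truncation, assumed as a hypothesis (a HIT in Book HoTT).
record PropTrunc : Setω where
  field
    ∥_∥      : ∀ {ℓ} → Set ℓ → Set ℓ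
    ∣_∣      : ∀ {ℓ} {A : Set ℓ} → A → ∥ A ∥
    ∥∥-isProp : ∀ {ℓ} {A : Set ℓ} → isProp ∥ A ∥
    ∥∥-rec   : ∀ {ℓ ℓ'} {A : Set ℓ} {B : Set ℓ'} → isProp B → (A → B) → ∥ A ∥ → B

Σ-≡-prop : ∀ {a b} {A : Set a} {B : A → Set b} → (∀ x → isProp (B x))
         → {u v : Σ A B} → proj₁ u ≡ proj₁ v → u ≡ v
Σ-≡-prop pr {x , b} {.x , b'} refl = cong (x ,_) (pr x b b')

private
  hedberg : ∀ {a} {A : Set a}
          → (f : ∀ {x y : A} → x ≡ y → x ≡ y)
          → (∀ {x y : A} (p q : x ≡ y) → f p ≡ f q)
          → isSet A
  hedberg {A = A} f c x y p q =
    trans (lem p) (trans (cong (trans (sym (f {x} {x} refl))) (c p q)) (sym (lem q)))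
    where
    lem : ∀ {z} (r : x ≡ z) → r ≡ trans (sym (f {x} {x} refl)) (f r)
    lem refl = sym (trans-symˡ (f {x} {x} refl))

Σ-isSet : ∀ {a b} {A : Set a} {B : A → Set b}
        → isSet A → (∀ x → isProp (B x)) → isSet (Σ A B)
Σ-isSet sA pB = hedberg (λ p → Σ-≡-prop pB (cong proj₁ p))
                        (λ p q → cong (Σ-≡-prop pB) (sA _ _ (cong proj₁ p) (cong proj₁ q)))

happly : ∀ {a b} {A : Set a} {B : A → Set b} {f g : (x : A) → B x}
       → f ≡ g → ∀ x → f x ≡ g x
happly refl x = refl

Π-isSet : FunExt → ∀ {a b} {A : Set a} {B : A → Set b}
        → (∀ x → isSet (B x)) → isSet ((x : A) → B x)
Π-isSet fe sB = hedberg (λ p → fe (happly p))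
                        (λ p q → cong fe (fe λ x → sB x _ _ (happly p x) (happly q x)))

Π-isProp : FunExt → ∀ {a b} {A : Set a} {B : A → Set b}
         → (∀ x → isProp (B x)) → isProp ((x : A) → B x)
Π-isProp fe pB f g = fe λ x → pB x (f x) (g x)

record Category (o h : Level) : Set (suc (o ⊔ h)) where
  infixr 9 _∘_
  field
    Ob     : Set o
    Hom    : Ob → Ob → Set h
    Hom-isSet : ∀ {a b} → isSet (Hom a b)
    id     : ∀ {a} → Hom a a
    _∘_    : ∀ {a b c} → Hom b c → Hom a b → Hom a c
    idl    : ∀ {a b} (f : Hom a b) → id ∘ f ≡ f
    idr    : ∀ {a b} (f : Hom a b) → f ∘ id ≡ f
    assoc  : ∀ {a b c d} (k : Hom c d) (g : Hom b c) (f : Hom a b)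
           → k ∘ (g ∘ f) ≡ (k ∘ g) ∘ f

open Category

Iso : ∀ {o h} (C : Category o h) → Ob C → Ob C → Set h
Iso C a b = Σ (Hom C a b) λ f → Σ (Hom C b a) λ g →
            (_∘_ C g f ≡ id C) × (_∘_ C f g ≡ id C)

idIso : ∀ {o h} (C : Category o h) {a : Ob C} → Iso C a a
idIso C = id C , id C , idl C (id C) , idl C (id C)

idtoiso : ∀ {o h} (C : Category o h) {a b : Ob C} → a ≡ b → Iso C a b
idtoiso C refl = idIso C

IsUnivalent : ∀ {o h} → Category o h → Set (o ⊔ h)
IsUnivalent C = ∀ (a b : Ob C) → isEquiv (idtoiso C {a} {b})

_∶_◁_ : ∀ {o h} (C : Category o h) → Ob C → Ob C → Set h
C ∶ X ◁ Y = Σ (Hom C Y X) λ r → Σ (Hom C X Y) λ s → _∘_ C r s ≡ id C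

record Functor {o h o' h'} (C : Category o h) (D : Category o' h')
       : Set (o ⊔ h ⊔ o' ⊔ h') where
  field
    F₀   : Ob C → Ob D
    F₁   : ∀ {a b} → Hom C a b → Hom D (F₀ a) (F₀ b)
    F-id : ∀ {a} → F₁ (id C {a}) ≡ id D
    F-∘  : ∀ {a b c} (g : Hom C b c) (f : Hom C a b)
         → F₁ (_∘_ C g f) ≡ _∘_ D (F₁ g) (F₁ f)

open Functor

FullyFaithful : ∀ {o h o' h'} {C : Category o h} {D : Category o' h'}
              → Functor C D → Set (o ⊔ h ⊔ h')
FullyFaithful {C = C} F = ∀ (a b : Ob C) → isEquiv (F₁ F {a} {b})

EssSurj : PropTrunc → ∀ {o h o' h'} {C : Category o h} {D : Category o' h'}
        → Functor C D → Set (o ⊔ o' ⊔ h')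
EssSurj pt {C = C} {D = D} F =
  ∀ (b : Ob D) → ∥ Σ (Ob C) (λ a → Iso D (F₀ F a) b) ∥
  where open PropTrunc pt

op : ∀ {o h} → Category o h → Category o h
op C = record
  { Ob = Ob C ; Hom = λ a b → Hom C b a ; Hom-isSet = Hom-isSet C
  ; id = id C ; _∘_ = λ g f → _∘_ C f g
  ; idl = idr C ; idr = idl C
  ; assoc = λ k g f → sym (assoc C f g k) }

SET : FunExt → (ℓ : Level) → Category (suc ℓ) ℓ
SET fe ℓ = record
  { Ob = Σ (Set ℓ) isSet
  ; Hom = λ A B → proj₁ A → proj₁ B
  ; Hom-isSet = λ {_} {B} → Π-isSet fe (λ _ → proj₂ B)
  ; id = λ x → x ; _∘_ = λ g f x → g (f x)
  ; idl = λ _ → refl ; idr = λ _ → refl ; assoc = λ _ _ _ → refl }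

module _ (fe : FunExt) {o h o' h'} (C : Category o h) (D : Category o' h') where
  private
    module D = Category D

  NatTrans : Functor C D → Functor C D → Set (o ⊔ h ⊔ h')
  NatTrans F G = Σ ((X : Ob C) → D.Hom (F₀ F X) (F₀ G X)) λ α →
                 ∀ (X Y : Ob C) (f : Hom C X Y) → F₁ G f D.∘ α X ≡ α Y D.∘ F₁ F f

  private
    nat-isProp : ∀ {F G : Functor C D} (α : (X : Ob C) → D.Hom (F₀ F X) (F₀ G X)) →
      isProp (∀ (X Y : Ob C) (f : Hom C X Y) → F₁ G f D.∘ α X ≡ α Y D.∘ F₁ F f)
    nat-isProp α = Π-isProp fe λ X → Π-isProp fe λ Y → Π-isProp fe λ f →
                   D.Hom-isSet _ _

    NT-≡ : ∀ {F G : Functor C D} {α β : NatTrans F G} → (∀ X → proj₁ α X ≡ proj₁ β X) → α ≡ β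
    NT-≡ {F} {G} p = Σ-≡-prop (nat-isProp {F} {G}) (fe p)

    idNT : ∀ {F : Functor C D} → NatTrans F F
    idNT {F} = (λ X → D.id) , λ X Y f → trans (D.idr _) (sym (D.idl _))

    compNT : ∀ {F G H : Functor C D} → NatTrans G H → NatTrans F G → NatTrans F H
    compNT {F} {G} {H} (β , nβ) (α , nα) = (λ X → β X D.∘ α X) , λ X Y f →
      trans (D.assoc _ _ _)
      (trans (cong (D._∘ α X) (nβ X Y f))
      (trans (sym (D.assoc _ _ _))
      (trans (cong (β Y D.∘_) (nα X Y f))
      (D.assoc _ _ _))))

  FunCat : Category (o ⊔ h ⊔ o' ⊔ h') (o ⊔ h ⊔ h')
  FunCat = record
    { Ob = Functor C D ; Hom = NatTrans
    ; Hom-isSet = λ {F} {G} → Σ-isSet (Π-isSet fe λ _ → D.Hom-isSet) (nat-isProp {F} {G})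
    ; id = λ {F} → idNT {F}
    ; _∘_ = λ {F} {G} {H} → compNT {F} {G} {H}
    ; idl = λ {F} {G} α → NT-≡ {F} {G} λ X → D.idl _
    ; idr = λ {F} {G} α → NT-≡ {F} {G} λ X → D.idr _
    ; assoc = λ {F} {_} {_} {G} k g f → NT-≡ {F} {G} λ X → D.assoc _ _ _ }

P : FunExt → ∀ {o h} → Category o h → Category (o ⊔ suc h) (o ⊔ h)
P fe {h = h} C = FunCat fe (op C) (SET fe h)

y : (fe : FunExt) → ∀ {o h} (C : Category o h) → Ob C → Ob (P fe C)
y fe C X = record
  { F₀ = λ Y → Hom C Y X , Hom-isSet C
  ; F₁ = λ f g → _∘_ C g f
  ; F-id = fe λ g → idr C g
  ; F-∘ = λ g f → fe λ k → assoc C k f g }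

FullSub : ∀ {o h p} (C : Category o h) → (Ob C → Set p) → Category (o ⊔ p) h
FullSub C Q = record
  { Ob = Σ (Ob C) Q ; Hom = λ a b → Hom C (proj₁ a) (proj₁ b)
  ; Hom-isSet = Hom-isSet C ; id = id C ; _∘_ = _∘_ C
  ; idl = idl C ; idr = idr C ; assoc = assoc C }

RU : PropTrunc → FunExt → ∀ {o h} → Category o h → Category (o ⊔ suc h) (o ⊔ h)
RU pt fe C = FullSub (P fe C) λ F → ∥ Σ (Ob C) (λ X → P fe C ∶ F ◁ y fe C X) ∥
  where open PropTrunc pt

module _ {o h} (C : Category o h) where
  private
    module C = Category C

  RObj : Set (o ⊔ h)
  RObj = Σ C.Ob λ X → Σ (C.Hom X X) λ f → f C.∘ f ≡ f

  RHom : RObj → RObj → Set h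
  RHom (X₁ , f₁ , _) (X₂ , f₂ , _) = Σ (C.Hom X₁ X₂) λ g → (f₂ C.∘ g) C.∘ f₁ ≡ g

  private
    absorbˡ : (A : RObj) (B : RObj) (g : RHom A B)
            → proj₁ (proj₂ B) C.∘ proj₁ g ≡ proj₁ g
    absorbˡ (X₁ , f₁ , e₁) (X₂ , f₂ , e₂) (g , pg) =
      trans (cong (f₂ C.∘_) (sym pg))
      (trans (C.assoc _ _ _)
      (trans (cong (C._∘ f₁) (C.assoc _ _ _))
      (trans (cong (λ z → (z C.∘ g) C.∘ f₁) e₂) pg)))

    absorbʳ : (A : RObj) (B : RObj) (g : RHom A B)
            → proj₁ g C.∘ proj₁ (proj₂ A) ≡ proj₁ g
    absorbʳ (X₁ , f₁ , e₁) (X₂ , f₂ , e₂) (g , pg) =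
      trans (cong (C._∘ f₁) (sym pg))
      (trans (sym (C.assoc _ _ _))
      (trans (cong ((f₂ C.∘ g) C.∘_) e₁) pg))

    RHom-≡ : ∀ {A B} {u v : RHom A B} → proj₁ u ≡ proj₁ v → u ≡ v
    RHom-≡ = Σ-≡-prop (λ _ → C.Hom-isSet _ _)

    Rid : ∀ {A} → RHom A A
    Rid {X , f , e} = f , trans (cong (C._∘ f) e) e

    Rcomp : ∀ {A B D} → RHom B D → RHom A B → RHom A D
    Rcomp {A} {B} {D} (k , pk) (g , pg) = k C.∘ g ,
      trans (cong (C._∘ proj₁ (proj₂ A)) (C.assoc _ _ _))
      (trans (sym (C.assoc _ _ _))
      (trans (cong₂' (absorbˡ B D (k , pk)) (absorbʳ A B (g , pg))) refl))
      where
      cong₂' : ∀ {x x' z z'} → x ≡ x' → z ≡ z' → x C.∘ z ≡ x' C.∘ z'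
      cong₂' refl refl = refl

  Rset : Category (o ⊔ h) h
  Rset = record
    { Ob = RObj ; Hom = RHom
    ; Hom-isSet = Σ-isSet C.Hom-isSet (λ _ → C.Hom-isSet _ _)
    ; id = λ {A} → Rid {A} ; _∘_ = λ {A} {B} {D} → Rcomp {A} {B} {D}
    ; idl = λ {A} {B} g → RHom-≡ {A} {B} (absorbˡ A B g)
    ; idr = λ {A} {B} g → RHom-≡ {A} {B} (absorbʳ A B g)
    ; assoc = λ {A} {_} {_} {B} k g f → RHom-≡ {A} {B} (C.assoc _ _ _) }

{-# OPTIONS --without-K #-}
-- SET is univalent by the univalence axiom, functor categories into a
-- univalent category are univalent, and so are full subcategories cut out by
-- a proposition; hence R^U(C) is univalent. An idempotent (X , f) goes to the
-- presheaf of maps g into X with f ∘ g = g, a retract of y X. By the Yoneda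
-- lemma a natural map between two such presheaves is determined by where it
-- sends f, which makes the functor fully faithful. Conversely a retraction
-- (r , s) : F ◁ y X yields the idempotent f = s (r id) on X, and F is
-- isomorphic to the presheaf it determines.
module Submission where

open import Defs
open import Level using (Level; _⊔_)
open import Data.Product using (Σ; _×_; _,_; proj₁; proj₂)
open import Relation.Binary.PropositionalEquality
  using (_≡_; refl; sym; trans; cong; cong₂; trans-symˡ; module ≡-Reasoning)
open import Function.Bundles using (mk↔ₛ′)
import Function.Properties.Inverse.HalfAdjointEquivalence as HAE
open import Axiom.UniquenessOfIdentityProofs using (module Constant⇒UIP)

open Category
open Functor

-- The half-adjoint coherence left-right is what contracts the fibres.
qinv⇒isEquiv : ∀ {a b} {A : Set a} {B : Set b} (f : A → B) (g : B → A)
             → (∀ y → f (g y) ≡ y) → (∀ x → g (f x) ≡ x) → isEquiv f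
qinv⇒isEquiv f g ε η y = (g y , R.right-inverse-of y) , contract
  where
  module R = HAE._≃_ (HAE.↔⇒≃ (mk↔ₛ′ f g ε η))
  fiber-≡ : ∀ {x z} (q : z ≡ x) (r : f z ≡ f x) → cong f q ≡ r
          → _≡_ {A = fiber f (f x)} (z , r) (x , refl)
  fiber-≡ refl .refl refl = refl
  contract : ∀ (w : fiber f y) → (g y , R.right-inverse-of y) ≡ w
  contract (x , refl) =
    fiber-≡ (R.left-inverse-of x) (R.right-inverse-of (f x)) (R.left-right x)

isContr-Σ⇒isEquiv : ∀ {a r} {A : Set a} {R : A → Set r} (x : A) (f : ∀ z → x ≡ z → R z)
                  → isContr (Σ A R) → ∀ z → isEquiv (f z)
isContr-Σ⇒isEquiv {A = A} {R} x f (_ , contract) z =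
  qinv⇒isEquiv (f z) (decode z) (λ r → encode-decode (path (z , r))) decode-encode
  where
  path : ∀ w → _≡_ {A = Σ A R} (x , f x refl) w
  path w = trans (sym (contract (x , f x refl))) (contract w)
  decode : ∀ z → R z → x ≡ z
  decode z r = cong proj₁ (path (z , r))
  encode-decode : ∀ {z r} (q : _≡_ {A = Σ A R} (x , f x refl) (z , r)) → f z (cong proj₁ q) ≡ r
  encode-decode refl = refl
  decode-encode : ∀ {z} (p : x ≡ z) → decode z (f z p) ≡ p
  decode-encode refl = cong (cong proj₁) (trans-symˡ (contract (x , f x refl)))

×-isProp : ∀ {a b} {A : Set a} {B : Set b} → isProp A → isProp B → isProp (A × B)
×-isProp pA pB (a , b) (a′ , b′) = cong₂ _,_ (pA a a′) (pB b b′)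

isProp⇒isSet : ∀ {a} {A : Set a} → isProp A → isSet A
isProp⇒isSet {A = A} pA x y =
  Constant⇒UIP.≡-irrelevant {A = A} (λ {a} {b} _ → trans (sym (pA a a)) (pA a b))
                                    (λ _ _ → refl)

isSet-isProp : FunExt → ∀ {a} {A : Set a} → isProp (isSet A)
isSet-isProp fe s₁ s₂ = fe λ x → fe λ y → fe λ p → fe λ q →
  isProp⇒isSet (s₁ x y) p q (s₁ x y p q) (s₂ x y p q)

Π-isContr-Σ : FunExt → ∀ {a b r} {A : Set a} {B : A → Set b} {R : ∀ x → B x → Set r}
            → (∀ x → isContr (Σ (B x) (R x)))
            → isContr (Σ ((x : A) → B x) λ g → ∀ x → R x (g x))
Π-isContr-Σ fe c =
  ((λ x → proj₁ (proj₁ (c x))) , (λ x → proj₂ (proj₁ (c x)))) ,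
  λ (g , r) → cong (λ φ → (λ x → proj₁ (φ x)) , (λ x → proj₂ (φ x)))
                   (fe λ x → proj₂ (c x) (g x , r x))

module _ {o h} (C : Category o h) where
  private
    module C = Category C

  isIso-isProp : ∀ {a b} (f : C.Hom a b)
               → isProp (Σ (C.Hom b a) λ g → (g C.∘ f ≡ C.id) × (f C.∘ g ≡ C.id))
  isIso-isProp f (g , gf , fg) (g′ , g′f , fg′) =
    Σ-≡-prop (λ _ → ×-isProp (C.Hom-isSet _ _) (C.Hom-isSet _ _)) inverse-unique
    where
    open ≡-Reasoning
    inverse-unique : g ≡ g′
    inverse-unique = begin
      g                 ≡⟨ sym (C.idr g) ⟩
      g C.∘ C.id        ≡⟨ cong (g C.∘_) (sym fg′) ⟩
      g C.∘ (f C.∘ g′)  ≡⟨ C.assoc g f g′ ⟩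
      (g C.∘ f) C.∘ g′  ≡⟨ cong (C._∘ g′) gf ⟩
      C.id C.∘ g′       ≡⟨ C.idl g′ ⟩
      g′                ∎

  Iso-≡ : ∀ {a b} {i j : Iso C a b} → proj₁ i ≡ proj₁ j → i ≡ j
  Iso-≡ = Σ-≡-prop isIso-isProp

  isContr-Iso⇒IsUnivalent : (∀ a → isContr (Σ C.Ob (Iso C a))) → IsUnivalent C
  isContr-Iso⇒IsUnivalent c a = isContr-Σ⇒isEquiv a (λ b → idtoiso C) (c a)

  IsUnivalent⇒isContr-Iso : IsUnivalent C → ∀ a → isContr (Σ C.Ob (Iso C a))
  IsUnivalent⇒isContr-Iso univ a = (a , idIso C) , λ (b , i) →
    let ((p , idtoiso-p≡i) , _) = univ a b i in
    trans (from-path p) (cong (b ,_) idtoiso-p≡i)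
    where
    from-path : ∀ {b} (p : a ≡ b) → _≡_ {A = Σ C.Ob (Iso C a)} (a , idIso C) (b , idtoiso C p)
    from-path refl = refl

FullSub-univalent : ∀ {o h p} {C : Category o h} {Q : Ob C → Set p}
                  → (∀ x → isProp (Q x)) → IsUnivalent C → IsUnivalent (FullSub C Q)
FullSub-univalent {C = C} {Q} Q-isProp univ =
  isContr-Iso⇒IsUnivalent (FullSub C Q) λ (a , qa) →
    ((a , qa) , idIso C) ,
    λ ((b , qb) , i) → into-FullSub (proj₂ (IsUnivalent⇒isContr-Iso C univ a) (b , i)) qb
  where
  into-FullSub : ∀ {a qa b} {i : Iso C a b}
               → _≡_ {A = Σ (Ob C) (Iso C a)} (a , idIso C) (b , i)
               → ∀ qb → _≡_ {A = Σ (Σ (Ob C) Q) (Iso (FullSub C Q) (a , qa))}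
                            ((a , qa) , idIso C) ((b , qb) , i)
  into-FullSub {a} {qa} refl qb = cong (λ q → ((a , q) , idIso C)) (Q-isProp a qa qb)

SET-univalent : Univalence → (fe : FunExt) (ℓ : Level) → IsUnivalent (SET fe ℓ)
SET-univalent ua fe ℓ =
  isContr-Iso⇒IsUnivalent (SET fe ℓ) λ A → (A , idIso (SET fe ℓ) {A}) , contract A
  where
  from-path : ∀ {A B : Set ℓ} (p : A ≡ B) (sA : isSet A) (sB : isSet B)
              (i : Iso (SET fe ℓ) (A , sA) (B , sB)) → proj₁ (idtoeqv p) ≡ proj₁ i
            → _≡_ {A = Σ (Σ (Set ℓ) isSet) (Iso (SET fe ℓ) (A , sA))}
                  ((A , sA) , idIso (SET fe ℓ) {A , sA}) ((B , sB) , i)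
  from-path refl sA sB i idtoeqv-p≡i with isSet-isProp fe sA sB
  ... | refl = cong ((_ , sA) ,_) (Iso-≡ (SET fe ℓ) {_ , sA} {_ , sA} idtoeqv-p≡i)

  contract : ∀ A (w : Σ (Σ (Set ℓ) isSet) (Iso (SET fe ℓ) A)) → (A , idIso (SET fe ℓ) {A}) ≡ w
  contract (A , sA) ((B , sB) , i@(f , g , gf , fg)) =
    let ((p , idtoeqv-p≡f) , _) = ua (f , qinv⇒isEquiv f g (happly fg) (happly gf)) in
    from-path p sA sB i (cong proj₁ idtoeqv-p≡f)

module _ (fe : FunExt) {o h o′ h′} {C : Category o h} {D : Category o′ h′} where
  private
    module C = Category C
    module D = Category D

    [C,D] : Category (o ⊔ h ⊔ o′ ⊔ h′) (o ⊔ h ⊔ h′)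
    [C,D] = FunCat fe C D

  NatTrans-≡ : ∀ {F G} {α β : NatTrans fe C D F G}
             → (∀ X → proj₁ α X ≡ proj₁ β X) → α ≡ β
  NatTrans-≡ {F} {G} p =
    Σ-≡-prop (λ _ → Π-isProp fe λ X → Π-isProp fe λ Y → Π-isProp fe λ _ →
                     D.Hom-isSet {F₀ F X} {F₀ G Y} _ _)
             (fe p)

  private
    functor : (G₀ : C.Ob → D.Ob) (G₁ : ∀ a b → C.Hom a b → D.Hom (G₀ a) (G₀ b))
            → (∀ a → G₁ a a C.id ≡ D.id)
            → (∀ a b c (g : C.Hom b c) (f : C.Hom a b)
               → G₁ a c (g C.∘ f) ≡ G₁ b c g D.∘ G₁ a b f)
            → Functor C D
    functor G₀ G₁ G-id G-∘ = record
      { F₀ = G₀ ; F₁ = λ {a b} → G₁ a b ; F-id = λ {a} → G-id a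
      ; F-∘ = λ {a b c} → G-∘ a b c }

    component : ∀ {F G} → Iso [C,D] F G → ∀ X → Iso D (F₀ F X) (F₀ G X)
    component ((α , _) , (β , _) , βα , αβ) X =
      α X , β X , cong (λ γ → proj₁ γ X) βα , cong (λ γ → proj₁ γ X) αβ

  -- Isomorphisms out of F are contracted in three layers, each of whose types
  -- depends on the previous one: the object parts by univalence of D, then
  -- the action, which naturality of an identity component forces to be F₁ F,
  -- and finally the functor laws, which are propositions.
  module _ (F : Functor C D) where
    private
      Iso-from-F : Set (o ⊔ h ⊔ o′ ⊔ h′)
      Iso-from-F = Σ (Functor C D) (Iso [C,D] F)

      collapse-laws
        : ∀ {G-id G-∘} → (λ a → F-id F {a}) ≡ G-id → (λ a b c → F-∘ F {a} {b} {c}) ≡ G-∘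
        → (i : Iso [C,D] F (functor (F₀ F) (λ a b → F₁ F) G-id G-∘))
        → (∀ X → proj₁ (proj₁ i) X ≡ D.id)
        → _≡_ {A = Iso-from-F} (F , idIso [C,D] {F})
                               (functor (F₀ F) (λ a b → F₁ F) G-id G-∘ , i)
      collapse-laws refl refl i α≡id =
        cong (F ,_) (Iso-≡ [C,D] {F} {F} (NatTrans-≡ {F} {F} λ X → sym (α≡id X)))

      collapse-action
        : ∀ {G₁} → (λ a b → F₁ F {a} {b}) ≡ G₁ → ∀ G-id G-∘
        → (i : Iso [C,D] F (functor (F₀ F) G₁ G-id G-∘))
        → (∀ X → proj₁ (proj₁ i) X ≡ D.id)
        → _≡_ {A = Iso-from-F} (F , idIso [C,D] {F}) (functor (F₀ F) G₁ G-id G-∘ , i)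
      collapse-action refl G-id G-∘ =
        collapse-laws (Π-isProp fe (λ _ → D.Hom-isSet _ _) _ G-id)
                      (Π-isProp fe (λ _ → Π-isProp fe λ _ → Π-isProp fe λ _ →
                                           Π-isProp fe λ _ → Π-isProp fe λ _ →
                                           D.Hom-isSet _ _) _ G-∘)

      collapse-objects
        : ∀ {G₀ e} → _≡_ {A = Σ (C.Ob → D.Ob) λ G₀ → ∀ X → Iso D (F₀ F X) (G₀ X)}
                         (F₀ F , λ X → idIso D) (G₀ , e)
        → ∀ G₁ G-id G-∘
        → (i : Iso [C,D] F (functor G₀ G₁ G-id G-∘))
        → (∀ X → proj₁ (proj₁ i) X ≡ proj₁ (e X))
        → _≡_ {A = Iso-from-F} (F , idIso [C,D] {F}) (functor G₀ G₁ G-id G-∘ , i)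
      collapse-objects refl G₁ G-id G-∘ i α≡id =
        collapse-action (fe λ a → fe λ b → fe λ f → F₁≡G₁ f) G-id G-∘ i α≡id
        where
        open ≡-Reasoning
        α : ∀ X → D.Hom (F₀ F X) (F₀ F X)
        α = proj₁ (proj₁ i)
        F₁≡G₁ : ∀ {a b} (f : C.Hom a b) → F₁ F f ≡ G₁ a b f
        F₁≡G₁ {a} {b} f = begin
          F₁ F f             ≡⟨ sym (D.idl _) ⟩
          D.id D.∘ F₁ F f    ≡⟨ cong (D._∘ F₁ F f) (sym (α≡id b)) ⟩
          α b D.∘ F₁ F f     ≡⟨ sym (proj₂ (proj₁ i) a b f) ⟩
          G₁ a b f D.∘ α a   ≡⟨ cong (G₁ a b f D.∘_) (α≡id a) ⟩
          G₁ a b f D.∘ D.id  ≡⟨ D.idr _ ⟩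
          G₁ a b f           ∎

    FunCat-isContr-Iso : IsUnivalent D → isContr Iso-from-F
    FunCat-isContr-Iso univ = (F , idIso [C,D] {F}) , λ (G , i) →
      collapse-objects (proj₂ objects-contr (F₀ G , component {F} {G} i))
                       (λ a b → F₁ G) (λ a → F-id G) (λ a b c → F-∘ G) i (λ X → refl)
      where
      objects-contr : isContr (Σ (C.Ob → D.Ob) λ G₀ → ∀ X → Iso D (F₀ F X) (G₀ X))
      objects-contr = Π-isContr-Σ fe λ X → IsUnivalent⇒isContr-Iso D univ (F₀ F X)

  FunCat-univalent : IsUnivalent D → IsUnivalent [C,D]
  FunCat-univalent univ = isContr-Iso⇒IsUnivalent [C,D] λ F → FunCat-isContr-Iso F univ

RU-univalent : Univalence → (fe : FunExt) (pt : PropTrunc) {o h : Level} (C : Category o h)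
             → IsUnivalent (RU pt fe C)
RU-univalent ua fe pt C =
  FullSub-univalent (λ _ → ∥∥-isProp) (FunCat-univalent fe (SET-univalent ua fe _))
  where open PropTrunc pt

module _ (fe : FunExt) {o h} (C : Category o h) where
  private
    module C = Category C

    PC : Category (o ⊔ Level.suc h) (o ⊔ h)
    PC = P fe C

  presheaf-hom-≡ : ∀ {F G} {α β : Hom PC F G}
                 → (∀ X x → proj₁ α X x ≡ proj₁ β X x) → α ≡ β
  presheaf-hom-≡ {F} {G} p = NatTrans-≡ fe {C = op C} {D = SET fe h} {F} {G} λ X → fe (p X)

  yoneda-natural : ∀ {X Y} {F : Ob PC} (α : Hom PC (y fe C X) F) (u : C.Hom Y X)
                 → proj₁ α Y u ≡ F₁ F u (proj₁ α X C.id)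
  yoneda-natural {X} {Y} α u =
    trans (cong (proj₁ α Y) (sym (C.idl u))) (sym (happly (proj₂ α X Y u) C.id))

  Fixed : RObj C → C.Ob → Set h
  Fixed (X , f , _) Y = Σ (C.Hom Y X) λ g → f C.∘ g ≡ g

  Fixed-≡ : ∀ {A Y} {u v : Fixed A Y} → proj₁ u ≡ proj₁ v → u ≡ v
  Fixed-≡ = Σ-≡-prop (λ _ → C.Hom-isSet _ _)

  -- Im (X , f) is the image of y f.
  Im : RObj C → Ob PC
  Im A = record
    { F₀ = λ Y → Fixed A Y , Σ-isSet C.Hom-isSet (λ _ → C.Hom-isSet _ _)
    ; F₁ = λ u (g , fg) → g C.∘ u , trans (C.assoc _ _ _) (cong (C._∘ u) fg)
    ; F-id = fe λ _ → Fixed-≡ {A} (C.idr _)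
    ; F-∘ = λ _ _ → fe λ _ → Fixed-≡ {A} (C.assoc _ _ _) }

  Im-generator : (A : RObj C) → Fixed A (proj₁ A)
  Im-generator (_ , f , ff) = f , ff

  Im-yoneda : ∀ {A Y} {F : Ob PC} (α : Hom PC (Im A) F) (u : Fixed A Y)
            → proj₁ α Y u ≡ F₁ F (proj₁ u) (proj₁ α (proj₁ A) (Im-generator A))
  Im-yoneda {A} α (g , fg) =
    trans (cong (proj₁ α _) (Fixed-≡ {A} (sym fg)))
          (sym (happly (proj₂ α _ _ g) (Im-generator A)))

  Im-retract : (A : RObj C) → PC ∶ Im A ◁ y fe C (proj₁ A)
  Im-retract A@(_ , f , ff) =
    ((λ _ g → f C.∘ g , trans (C.assoc _ _ _) (cong (C._∘ g) ff)) ,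
     (λ _ _ _ → fe λ _ → Fixed-≡ {A} (sym (C.assoc _ _ _)))) ,
    ((λ _ → proj₁) , (λ _ _ _ → refl)) ,
    presheaf-hom-≡ {Im A} {Im A} λ _ (_ , fg) → Fixed-≡ {A} fg

  module _ {F : Ob PC} {X : C.Ob} (ρ : PC ∶ F ◁ y fe C X) where
    private
      r = proj₁ (proj₁ ρ)
      s = proj₁ (proj₁ (proj₂ ρ))

      rs : ∀ Y a → r Y (s Y a) ≡ a
      rs Y = happly (cong (λ γ → proj₁ γ Y) (proj₂ (proj₂ ρ)))

      sr : ∀ Y (u : C.Hom Y X) → s Y (r Y u) ≡ s X (r X C.id) C.∘ u
      sr Y = yoneda-natural {F = y fe C X}
               (_∘_ PC {y fe C X} {F} {y fe C X} (proj₁ (proj₂ ρ)) (proj₁ ρ))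

    retract-idempotent : RObj C
    retract-idempotent = X , f , trans (sym (sr X f)) (cong (s X) (rs X (r X C.id)))
      where
      f = s X (r X C.id)

    retract-≅-Im : Iso PC (Im retract-idempotent) F
    retract-≅-Im = to , from ,
      presheaf-hom-≡ {Im retract-idempotent} {Im retract-idempotent}
        (λ Y (g , fg) → Fixed-≡ {retract-idempotent} (trans (sr Y g) fg)) ,
      presheaf-hom-≡ {F} {F} rs
      where
      to : Hom PC (Im retract-idempotent) F
      to = (λ Y (g , _) → r Y g) , λ Y Z u → fe λ (g , _) → happly (proj₂ (proj₁ ρ) Y Z u) g
      from : Hom PC F (Im retract-idempotent)
      from = (λ Y a → s Y a , trans (sym (sr Y (s Y a))) (cong (s Y) (rs Y a))) ,
             λ Y Z u → fe λ a →
               Fixed-≡ {retract-idempotent} (happly (proj₂ (proj₁ (proj₂ ρ)) Y Z u) a)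

  module _ {A B : RObj C} (g : RHom C A B) where
    absorbˡ : proj₁ (proj₂ B) C.∘ proj₁ g ≡ proj₁ g
    absorbˡ = cong proj₁ (idl (Rset C) {A} {B} g)

    absorbʳ : proj₁ g C.∘ proj₁ (proj₂ A) ≡ proj₁ g
    absorbʳ = cong proj₁ (idr (Rset C) {A} {B} g)

  postcompose : ∀ {A B} → RHom C A B → Hom PC (Im A) (Im B)
  postcompose {A} {B} g =
    (λ Y (u , _) → proj₁ g C.∘ u , trans (C.assoc _ _ _) (cong (C._∘ u) (absorbˡ {A} {B} g))) ,
    λ _ _ _ → fe λ _ → Fixed-≡ {B} (sym (C.assoc _ _ _))

  postcompose-isEquiv : ∀ A B → isEquiv (postcompose {A} {B})
  postcompose-isEquiv A@(X₁ , f₁ , _) B =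
    qinv⇒isEquiv (postcompose {A} {B}) element postcompose-element element-postcompose
    where
    element : Hom PC (Im A) (Im B) → RHom C A B
    element α = proj₁ g , trans (cong (C._∘ f₁) (proj₂ g))
                                (sym (cong proj₁ (Im-yoneda {F = Im B} α (Im-generator A))))
      where
      g = proj₁ α X₁ (Im-generator A)

    postcompose-element : ∀ α → postcompose {A} {B} (element α) ≡ α
    postcompose-element α = presheaf-hom-≡ {Im A} {Im B} λ _ u →
      Fixed-≡ {B} (sym (cong proj₁ (Im-yoneda {F = Im B} α u)))

    element-postcompose : ∀ g → element (postcompose {A} {B} g) ≡ g
    element-postcompose g = Σ-≡-prop (λ _ → C.Hom-isSet _ _) (absorbʳ {A} {B} g)

  module _ (pt : PropTrunc) where
    open PropTrunc pt

    Im-functor : Functor (Rset C) (RU pt fe C)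
    Im-functor = record
      { F₀ = λ A → Im A , ∣ proj₁ A , Im-retract A ∣
      ; F₁ = λ {A} {B} → postcompose {A} {B}
      ; F-id = λ {A} → presheaf-hom-≡ {Im A} {Im A} λ _ (_ , fg) → Fixed-≡ {A} fg
      ; F-∘ = λ {A} {_} {B} _ _ →
                presheaf-hom-≡ {Im A} {Im B} λ _ _ → Fixed-≡ {B} (sym (C.assoc _ _ _)) }

    Im-functor-fullyFaithful : FullyFaithful Im-functor
    Im-functor-fullyFaithful = postcompose-isEquiv

    Im-functor-essSurj : EssSurj pt Im-functor
    Im-functor-essSurj (F , merely-retract) =
      ∥∥-rec ∥∥-isProp (λ (_ , ρ) → ∣ retract-idempotent {F} ρ , retract-≅-Im {F} ρ ∣)
             merely-retract

theorem47 : (ua : Univalence) (fe : FunExt) (pt : PropTrunc)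
            {o h : Level} (C : Category o h)
          → IsUnivalent (RU pt fe C)
            × Σ (Functor (Rset C) (RU pt fe C))
                (λ F → FullyFaithful F × EssSurj pt F)
theorem47 ua fe pt C =
  RU-univalent ua fe pt C ,
  Im-functor fe C pt , Im-functor-fullyFaithful fe C pt , Im-functor-essSurj fe C pt
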